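{- Let $n=4k+3$ for some integer $k\geq 1$. Then there exists a signed graph $\Gamma$ which is cospectral with the path $P_n$ but not switching isomorphic with $P_n$.
   Context: A signed graph $\Gamma=(G,\sigma)$ is a simple graph $G=(V,E)$ together with a map $\sigma:E\to\{ -1,+1\}$. Its adjacency matrix is obtained from the $(0,1)$-adjacency matrix of $G$ by replacing the entry $1$ by $-1$ for each negative edge; the spectrum of $\Gamma$ is the spectrum of this matrix. Two signed graphs are cospectral if they have the same spectrum. Switching with respect to a vertex subset $X$ changes the sign of every edge with exactly one end in $X$. Two signed graphs are switching isomorphic if one can be switched into a signed graph isomorphic to the other. The path $P_n$ is regarded as a signed graph with all edges positive. -}

module Defs where

open import Data.Nat as ℕ using (ℕ; zero; suc)
open import Data.Integer as ℤ using (ℤ; +_; -_; _*_; _+_; _-_)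
open import Data.Fin using (Fin; zero; suc; toℕ; punchIn)
open import Data.Maybe using (Maybe; just; nothing)
open import Data.Sign using (Sign)
open import Data.Bool using (Bool; true; false; if_then_else_)
open import Data.Product using (Σ; _×_; ∃)
open import Relation.Binary.PropositionalEquality using (_≡_; refl; cong)
import Data.Bool.Properties
open import Function.Bundles using (_↔_; Inverse)

record SignedGraph (n : ℕ) : Set where
  field
    edge      : Fin n → Fin n → Maybe Sign
    symmetric : ∀ i j → edge i j ≡ edge j i
    loopless  : ∀ i → edge i i ≡ nothing
open SignedGraph public

signValue : Sign → ℤ
signValue Sign.+ = + 1
signValue Sign.- = - (+ 1)

adjacency : ∀ {n} → SignedGraph n → Fin n → Fin n → ℤ
adjacency Γ i j with edge Γ i j
... | nothing = + 0
... | just s  = signValue s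

sumFin : ∀ n → (Fin n → ℤ) → ℤ
sumFin zero    f = + 0
sumFin (suc n) f = f zero + sumFin n (λ j → f (suc j))

altSign : ℕ → ℤ
altSign zero          = + 1
altSign (suc zero)    = - (+ 1)
altSign (suc (suc m)) = altSign m

det : ∀ n → (Fin n → Fin n → ℤ) → ℤ
det zero    M = + 1
det (suc n) M =
  sumFin (suc n) (λ j → altSign (toℕ j) * (M zero j * det n (λ r c → M (suc r) (punchIn j c))))

identity : ∀ {n} → Fin n → Fin n → ℤ
identity zero    zero    = + 1
identity zero    (suc j) = + 0
identity (suc i) zero    = + 0
identity (suc i) (suc j) = identity i j

charPoly : ∀ {n} → SignedGraph n → ℤ → ℤ
charPoly {n} Γ x = det n (λ i j → x * identity i j - adjacency Γ i j)

Cospectral : ∀ {n} → SignedGraph n → SignedGraph n → Set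
Cospectral Γ Δ = ∀ x → charPoly Γ x ≡ charPoly Δ x

-- Switching with respect to X ⊆ V (given by its indicator function):
-- flip the sign of every edge with exactly one end in X.
flipIf : Bool → Sign → Sign
flipIf false s = s
flipIf true  s = Data.Sign.opposite s

xor : Bool → Bool → Bool
xor false b = b
xor true  b = Data.Bool.not b

switchEdge : Bool → Maybe Sign → Maybe Sign
switchEdge b nothing  = nothing
switchEdge b (just s) = just (flipIf b s)

SwitchingIsomorphic : ∀ {n} → SignedGraph n → SignedGraph n → Set
SwitchingIsomorphic {n} Γ Δ =
  Σ (Fin n → Bool) λ X →
  Σ (Fin n ↔ Fin n) λ π →
    ∀ i j → switchEdge (xor (X (Inverse.to π i)) (X (Inverse.to π j)))
                       (edge Γ (Inverse.to π i) (Inverse.to π j))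
            ≡ edge Δ i j

consecutive : ℕ → ℕ → Bool
consecutive m k = (m ℕ.≡ᵇ suc k) Data.Bool.∨ (k ℕ.≡ᵇ suc m)

pathEdge : ∀ {n} → Fin n → Fin n → Maybe Sign
pathEdge i j = if consecutive (toℕ i) (toℕ j) then just Sign.+ else nothing

private
  noSelf : ∀ m → (m ℕ.≡ᵇ suc m) ≡ false
  noSelf zero    = refl
  noSelf (suc m) = noSelf m

  consec-sym : ∀ m k → consecutive m k ≡ consecutive k m
  consec-sym m k = Data.Bool.Properties.∨-comm (m ℕ.≡ᵇ suc k) (k ℕ.≡ᵇ suc m)

  consec-irr : ∀ m → consecutive m m ≡ false
  consec-irr m rewrite noSelf m = refl

path : ∀ n → SignedGraph n
path n = record
  { edge      = pathEdge
  ; symmetric = λ i j → cong (λ b → if b then just Sign.+ else nothing) (consec-sym (toℕ i) (toℕ j))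
  ; loopless  = λ i → cong (λ b → if b then just Sign.+ else nothing) (consec-irr (toℕ i))
  }

{-# OPTIONS --safe #-}
-- Write U n for the characteristic polynomial of the path on n − 1 vertices (a Chebyshev
-- polynomial of the second kind) and V n = U (n + 2) − U n.  The doubling formula
-- U (2a + 2) = U (a + 1) · V a, applied twice, gives χ(P_{4k+3}) = U (4k + 4) = U (k + 1) · V k · V (2k + 1).
--
-- Γ is the disjoint union of P_k and a negative quadrangle carrying pendant paths on k − 1 and 2k
-- vertices at two opposite corners.  The vertices are numbered so that Laplace expansion along the
-- first row and column always removes a vertex of degree at most one in what remains; every pendant
-- path then contributes a Chebyshev recurrence, and only a few minors of the quadrangle itself have
-- to be computed, which is done symbolically.  The result is χ(Γ) = U (k + 1) · V k · V (2k + 1) as well.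
--
-- Switching preserves the underlying graph, and Γ has a vertex of degree three while a path has
-- none, so Γ is not switching isomorphic with P_{4k+3}.
module Submission where

open import Data.Nat as ℕ using (ℕ; zero; suc)
import Data.Nat.Properties as ℕ
open import Data.Fin as Fin using (Fin; zero; suc; toℕ; punchIn; fromℕ)
import Data.Fin.Properties as Fin
open import Function using (_∘_)
open import Relation.Binary.PropositionalEquality
open import Relation.Nullary using (¬_; contradiction)

open import Defs

module Laplace where

  open import Data.Integer using (ℤ; 0ℤ; 1ℤ; -_; _+_; _*_; _-_)
  open import Data.Integer.Properties
    using (+-identityˡ; +-identityʳ; *-zeroˡ; *-zeroʳ; *-distribˡ-+; *-assoc; *-identityˡ)
  open import Data.Integer.Tactic.RingSolver using (solve-∀)
  open ≡-Reasoning

  Matrix : ℕ → Set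
  Matrix n = Fin n → Fin n → ℤ

  minor : ∀ {n} → Matrix (suc n) → Fin (suc n) → Fin (suc n) → Matrix n
  minor M i j r c = M (punchIn i r) (punchIn j c)

  sumFin-cong : ∀ n {f g : Fin n → ℤ} → (∀ j → f j ≡ g j) → sumFin n f ≡ sumFin n g
  sumFin-cong zero    f≗g = refl
  sumFin-cong (suc n) f≗g = cong₂ _+_ (f≗g zero) (sumFin-cong n (f≗g ∘ suc))

  sumFin-zero : ∀ n {f : Fin n → ℤ} → (∀ j → f j ≡ 0ℤ) → sumFin n f ≡ 0ℤ
  sumFin-zero zero    f≗0 = refl
  sumFin-zero (suc n) f≗0 = cong₂ _+_ (f≗0 zero) (sumFin-zero n (f≗0 ∘ suc))

  *-distribˡ-sumFin : ∀ n k (f : Fin n → ℤ) → k * sumFin n f ≡ sumFin n (λ j → k * f j)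
  *-distribˡ-sumFin zero    k f = *-zeroʳ k
  *-distribˡ-sumFin (suc n) k f =
    trans (*-distribˡ-+ k (f zero) _) (cong (k * f zero +_) (*-distribˡ-sumFin n k (f ∘ suc)))

  sumFin-single : ∀ n (f : Fin n → ℤ) q → (∀ j → j ≢ q → f j ≡ 0ℤ) → sumFin n f ≡ f q
  sumFin-single (suc n) f zero    f≗0 =
    trans (cong (f zero +_) (sumFin-zero n (λ j → f≗0 (suc j) λ ()))) (+-identityʳ (f zero))
  sumFin-single (suc n) f (suc q) f≗0 =
    trans (cong (_+ sumFin n (f ∘ suc)) (f≗0 zero λ ()))
          (trans (+-identityˡ _) (sumFin-single n (f ∘ suc) q (λ j j≢q → f≗0 (suc j) (j≢q ∘ Fin.suc-injective))))

  altSign-suc : ∀ t → altSign (suc t) ≡ - altSign t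
  altSign-suc zero          = refl
  altSign-suc (suc zero)    = refl
  altSign-suc (suc (suc t)) = altSign-suc t

  altSign-square : ∀ t → altSign t * altSign t ≡ 1ℤ
  altSign-square zero          = refl
  altSign-square (suc zero)    = refl
  altSign-square (suc (suc t)) = altSign-square t

  cofactor : ∀ n → Matrix (suc n) → Fin (suc n) → ℤ
  cofactor n M j = altSign (toℕ j) * (M zero j * det n (minor M zero j))

  det-cong : ∀ n {M N : Matrix n} → (∀ r c → M r c ≡ N r c) → det n M ≡ det n N
  det-cong zero    M≗N = refl
  det-cong (suc n) M≗N = sumFin-cong (suc n) λ j →
    cong₂ (λ a d → altSign (toℕ j) * (a * d)) (M≗N zero j) (det-cong n (λ r c → M≗N (suc r) (punchIn j c)))

  cofactor-zeroEntry : ∀ s {a} d → a ≡ 0ℤ → s * (a * d) ≡ 0ℤ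
  cofactor-zeroEntry s d refl = trans (cong (s *_) (*-zeroˡ d)) (*-zeroʳ s)

  cofactor-zeroMinor : ∀ s a {d} → d ≡ 0ℤ → s * (a * d) ≡ 0ℤ
  cofactor-zeroMinor s a refl = trans (cong (s *_) (*-zeroʳ a)) (*-zeroʳ s)

  det-zeroColumn : ∀ n (M : Matrix (suc n)) → (∀ r → M r zero ≡ 0ℤ) → det (suc n) M ≡ 0ℤ
  det-zeroColumn zero    M column = sumFin-zero 1 {cofactor zero M} λ
    { zero → cofactor-zeroEntry 1ℤ 1ℤ (column zero) }
  det-zeroColumn (suc n) M column = sumFin-zero (suc (suc n)) {cofactor (suc n) M} λ
    { zero    → cofactor-zeroEntry 1ℤ (det (suc n) (minor M zero zero)) (column zero)
    ; (suc j) → cofactor-zeroMinor (altSign (toℕ (suc j))) (M zero (suc j))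
                  (det-zeroColumn n (minor M zero (suc j)) (column ∘ suc))
    }

  det-singleEntryColumn : ∀ n (M : Matrix (suc n)) i → (∀ r → r ≢ i → M r zero ≡ 0ℤ) →
                          det (suc n) M ≡ altSign (toℕ i) * (M i zero * det n (minor M i zero))
  det-singleEntryColumn zero    M zero    _      = +-identityʳ _
  det-singleEntryColumn (suc n) M zero    column =
    trans (cong (cofactor (suc n) M zero +_) (sumFin-zero (suc n) {cofactor (suc n) M ∘ suc} λ j →
             cofactor-zeroMinor (altSign (toℕ (suc j))) (M zero (suc j))
               (det-zeroColumn n (minor M zero (suc j)) (λ r → column (suc r) λ ()))))
          (+-identityʳ _)
  det-singleEntryColumn (suc n) M (suc i) column = begin
      cofactor (suc n) M zero + sumFin (suc n) (cofactor (suc n) M ∘ suc)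
    ≡⟨ cong (_+ sumFin (suc n) (cofactor (suc n) M ∘ suc))
            (cofactor-zeroEntry 1ℤ (det (suc n) (minor M zero zero)) (column zero λ ())) ⟩
      0ℤ + sumFin (suc n) (cofactor (suc n) M ∘ suc)
    ≡⟨ +-identityˡ _ ⟩
      sumFin (suc n) (cofactor (suc n) M ∘ suc)
    ≡⟨ sumFin-cong (suc n) expand ⟩
      sumFin (suc n) (λ j → k * cofactor n (minor M (suc i) zero) j)
    ≡⟨ *-distribˡ-sumFin (suc n) k (cofactor n (minor M (suc i) zero)) ⟨
      k * det (suc n) (minor M (suc i) zero)
    ≡⟨ *-assoc (altSign (toℕ (suc i))) (M (suc i) zero) _ ⟩
      altSign (toℕ (suc i)) * (M (suc i) zero * det (suc n) (minor M (suc i) zero))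
    ∎
    where
    k : ℤ
    k = altSign (toℕ (suc i)) * M (suc i) zero
    reassociate : ∀ sᵢ sⱼ a b d → (- sⱼ) * (a * (sᵢ * (b * d))) ≡ ((- sᵢ) * b) * (sⱼ * (a * d))
    reassociate = solve-∀
    expand : ∀ j → cofactor (suc n) M (suc j) ≡ k * cofactor n (minor M (suc i) zero) j
    expand j
      rewrite altSign-suc (toℕ j) | altSign-suc (toℕ i)
            | det-singleEntryColumn n (minor M zero (suc j)) i (λ r r≢i → column (suc r) (r≢i ∘ Fin.suc-injective))
      = reassociate (altSign (toℕ i)) (altSign (toℕ j)) (M zero (suc j)) (M (suc i) zero) _
  det-pendant : ∀ n (M : Matrix (suc (suc n))) p →
                (∀ r → r ≢ p → M (suc r) zero ≡ 0ℤ) → (∀ c → c ≢ p → M zero (suc c) ≡ 0ℤ) →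
                det (suc (suc n)) M ≡ M zero zero * det (suc n) (minor M zero zero)
                                      - M zero (suc p) * M (suc p) zero * det n (minor (minor M zero zero) p p)
  det-pendant n M p column row = begin
      cofactor (suc n) M zero + sumFin (suc n) (cofactor (suc n) M ∘ suc)
    ≡⟨ cong (cofactor (suc n) M zero +_) (sumFin-single (suc n) (cofactor (suc n) M ∘ suc) p
         (λ c c≢p → cofactor-zeroEntry (altSign (toℕ (suc c))) (det (suc n) (minor M zero (suc c))) (row c c≢p))) ⟩
      cofactor (suc n) M zero + cofactor (suc n) M (suc p)
    ≡⟨ cong (λ d → cofactor (suc n) M zero + altSign (toℕ (suc p)) * (M zero (suc p) * d))
            (det-singleEntryColumn n (minor M zero (suc p)) p column) ⟩
      1ℤ * (a * d₁) + altSign (suc (toℕ p)) * (b * (altSign (toℕ p) * (c * d₂)))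
    ≡⟨ cong (λ s → 1ℤ * (a * d₁) + s * (b * (altSign (toℕ p) * (c * d₂)))) (altSign-suc (toℕ p)) ⟩
      1ℤ * (a * d₁) + (- altSign (toℕ p)) * (b * (altSign (toℕ p) * (c * d₂)))
    ≡⟨ collect a b c d₁ d₂ (altSign (toℕ p)) ⟩
      a * d₁ - (altSign (toℕ p) * altSign (toℕ p)) * (b * c * d₂)
    ≡⟨ cong (λ s → a * d₁ - s * (b * c * d₂)) (altSign-square (toℕ p)) ⟩
      a * d₁ - 1ℤ * (b * c * d₂)
    ≡⟨ cong (λ e → a * d₁ - e) (*-identityˡ (b * c * d₂)) ⟩
      a * d₁ - b * c * d₂
    ∎
    where
    a = M zero zero
    b = M zero (suc p)
    c = M (suc p) zero
    d₁ = det (suc n) (minor M zero zero)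
    d₂ = det n (minor (minor M zero zero) p p)
    collect : ∀ a b c d₁ d₂ s → 1ℤ * (a * d₁) + (- s) * (b * (s * (c * d₂))) ≡ a * d₁ - (s * s) * (b * c * d₂)
    collect = solve-∀

open Laplace

module PrincipalMinors where

  open import Data.Integer using (ℤ; 0ℤ; 1ℤ; _+_; _*_; _-_)
  open import Data.Integer.Properties using (*-identityˡ)
  open import Data.Integer.Tactic.RingSolver using (solve-∀)
  open ≡-Reasoning

  window : (ℕ → ℕ → ℤ) → ℕ → (n : ℕ) → Matrix n
  window f d n r c = f (toℕ r ℕ.+ d) (toℕ c ℕ.+ d)

  principalMinor : (ℕ → ℕ → ℤ) → ℕ → ℕ → ℤ
  principalMinor f d n = det n (window f d n)

  minor-window : ∀ f d n r c → minor (window f d (suc n)) zero zero r c ≡ window f (suc d) n r c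
  minor-window f d n r c = sym (cong₂ f (ℕ.+-suc (toℕ r) d) (ℕ.+-suc (toℕ c) d))

  det-minor-window : ∀ f d n → det n (minor (window f d (suc n)) zero zero) ≡ principalMinor f (suc d) n
  det-minor-window f d n = det-cong n (minor-window f d n)

  principalMinor-one : ∀ f d → principalMinor f d 1 ≡ f d d
  principalMinor-one f d = solve (f d d)
    where
    solve : ∀ a → 1ℤ * (a * 1ℤ) + 0ℤ ≡ a
    solve = solve-∀

  principalMinor-isolated : ∀ f d n → (∀ j → d ℕ.< j → f j d ≡ 0ℤ) →
                            principalMinor f d (suc n) ≡ f d d * principalMinor f (suc d) n
  principalMinor-isolated f d n column = begin
      principalMinor f d (suc n)
    ≡⟨ det-singleEntryColumn n (window f d (suc n)) zero below ⟩
      1ℤ * (f d d * det n (minor (window f d (suc n)) zero zero))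
    ≡⟨ *-identityˡ _ ⟩
      f d d * det n (minor (window f d (suc n)) zero zero)
    ≡⟨ cong (f d d *_) (det-minor-window f d n) ⟩
      f d d * principalMinor f (suc d) n
    ∎
    where
    below : ∀ r → r ≢ zero → window f d (suc n) r zero ≡ 0ℤ
    below zero    0≢0 = contradiction refl 0≢0
    below (suc r) _   = column _ (ℕ.s≤s (ℕ.m≤n+m d (toℕ r)))

  principalMinor-pendant : ∀ f d n →
    (∀ j → suc d ℕ.< j → f j d ≡ 0ℤ) → (∀ j → suc d ℕ.< j → f d j ≡ 0ℤ) →
    principalMinor f d (suc (suc n)) ≡
      f d d * principalMinor f (suc d) (suc n) - f d (suc d) * f (suc d) d * principalMinor f (suc (suc d)) n
  principalMinor-pendant f d n column row =
    trans (det-pendant n (window f d (suc (suc n))) zero (beyond column) (beyond row))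
          (cong₂ (λ d₁ d₂ → f d d * d₁ - f d (suc d) * f (suc d) d * d₂)
                 (det-minor-window f d (suc n))
                 (det-cong n (λ r c → trans (minor-window f d (suc n) (suc r) (suc c)) (minor-window f (suc d) n r c))))
    where
    beyond : ∀ {g : ℕ → ℤ} → (∀ j → suc d ℕ.< j → g j ≡ 0ℤ) →
             ∀ (r : Fin (suc n)) → r ≢ zero → g (suc (toℕ r) ℕ.+ d) ≡ 0ℤ
    beyond g≡0 zero    0≢0 = contradiction refl 0≢0
    beyond g≡0 (suc r) _   = g≡0 _ (ℕ.s≤s (ℕ.s≤s (ℕ.m≤n+m d (toℕ r))))

  toℕ-punchIn-fromℕ : ∀ n (r : Fin n) → toℕ (punchIn (fromℕ n) r) ≡ toℕ r
  toℕ-punchIn-fromℕ (suc n) zero    = refl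
  toℕ-punchIn-fromℕ (suc n) (suc r) = cong suc (toℕ-punchIn-fromℕ n r)

  ≢fromℕ⇒toℕ< : ∀ n (r : Fin (suc n)) → r ≢ fromℕ n → toℕ r ℕ.< n
  ≢fromℕ⇒toℕ< zero    zero    0≢0 = contradiction refl 0≢0
  ≢fromℕ⇒toℕ< (suc n) zero    _   = ℕ.s≤s ℕ.z≤n
  ≢fromℕ⇒toℕ< (suc n) (suc r) r≢n = ℕ.s≤s (≢fromℕ⇒toℕ< n r (r≢n ∘ cong suc))

  principalMinor-pendantLast : ∀ f d n →
    (∀ j → d ℕ.< j → j ℕ.< suc n ℕ.+ d → f j d ≡ 0ℤ) → (∀ j → d ℕ.< j → j ℕ.< suc n ℕ.+ d → f d j ≡ 0ℤ) →
    principalMinor f d (suc (suc n)) ≡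
      f d d * principalMinor f (suc d) (suc n) - f d (suc n ℕ.+ d) * f (suc n ℕ.+ d) d * principalMinor f (suc d) n
  principalMinor-pendantLast f d n column row = begin
      principalMinor f d (suc (suc n))
    ≡⟨ det-pendant n W (fromℕ n) (inside column) (inside row) ⟩
      f d d * det (suc n) (minor W zero zero) - f d l′ * f l′ d * det n (minor (minor W zero zero) (fromℕ n) (fromℕ n))
    ≡⟨ cong₃ (det-minor-window f d (suc n)) (cong (λ i → suc i ℕ.+ d) (Fin.toℕ-fromℕ n)) (det-cong n dropLast) ⟩
      f d d * principalMinor f (suc d) (suc n) - f d l * f l d * principalMinor f (suc d) n
    ∎
    where
    W = window f d (suc (suc n))
    l′ = suc (toℕ (fromℕ n)) ℕ.+ d
    l = suc n ℕ.+ d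
    cong₃ : ∀ {d₁ d₁′ i i′ d₂ d₂′} → d₁ ≡ d₁′ → i ≡ i′ → d₂ ≡ d₂′ →
            f d d * d₁ - f d i * f i d * d₂ ≡ f d d * d₁′ - f d i′ * f i′ d * d₂′
    cong₃ refl refl refl = refl
    inside : ∀ {g : ℕ → ℤ} → (∀ j → d ℕ.< j → j ℕ.< suc n ℕ.+ d → g j ≡ 0ℤ) →
             ∀ (r : Fin (suc n)) → r ≢ fromℕ n → g (suc (toℕ r) ℕ.+ d) ≡ 0ℤ
    inside g≡0 r r≢n = g≡0 _ (ℕ.s≤s (ℕ.m≤n+m d (toℕ r))) (ℕ.s≤s (ℕ.+-monoˡ-< d (≢fromℕ⇒toℕ< n r r≢n)))
    dropLast : ∀ r c → minor (minor (window f d (suc (suc n))) zero zero) (fromℕ n) (fromℕ n) r c ≡ window f (suc d) n r c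
    dropLast r c = cong₂ f (shift r) (shift c)
      where
      shift : ∀ r → suc (toℕ (punchIn (fromℕ n) r)) ℕ.+ d ≡ toℕ r ℕ.+ suc d
      shift r = trans (cong (λ i → suc i ℕ.+ d) (toℕ-punchIn-fromℕ n r)) (sym (ℕ.+-suc (toℕ r) d))

  -- U x n = U_{n-1}(x/2), with U the Chebyshev polynomials of the second kind.
  U : ℤ → ℕ → ℤ
  U x zero          = 0ℤ
  U x (suc zero)    = 1ℤ
  U x (suc (suc n)) = x * U x (suc n) - U x n

  U-+ : ∀ x a b → U x (suc (a ℕ.+ b)) ≡ U x (suc a) * U x (suc b) - U x a * U x b
  U-+ x a zero = trans (cong (U x ∘ suc) (ℕ.+-identityʳ a)) (base (U x (suc a)) (U x a))
    where
    base : ∀ p q → p ≡ p * 1ℤ - q * 0ℤ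
    base = solve-∀
  U-+ x a (suc zero) = trans (cong (U x ∘ suc) (ℕ.+-comm a 1)) (step x (U x (suc a)) (U x a))
    where
    step : ∀ x p q → x * p - q ≡ p * (x * 1ℤ - 0ℤ) - q * 1ℤ
    step = solve-∀
  U-+ x a (suc (suc b)) = begin
      U x (suc (a ℕ.+ suc (suc b)))
    ≡⟨ cong (U x ∘ suc) (ℕ.+-suc a (suc b)) ⟩
      x * U x (suc (a ℕ.+ suc b)) - U x (a ℕ.+ suc b)
    ≡⟨ cong₂ (λ u v → x * u - v) (U-+ x a (suc b)) (trans (cong (U x) (ℕ.+-suc a b)) (U-+ x a b)) ⟩
      x * (U x (suc a) * U x (suc (suc b)) - U x a * U x (suc b)) - (U x (suc a) * U x (suc b) - U x a * U x b)
    ≡⟨ step x (U x (suc a)) (U x a) (U x (suc b)) (U x b) ⟩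
      U x (suc a) * U x (suc (suc (suc b))) - U x a * U x (suc (suc b))
    ∎
    where
    step : ∀ x p q u v → x * (p * (x * u - v) - q * u) - (p * u - q * v) ≡ p * (x * (x * u - v) - u) - q * (x * u - v)
    step = solve-∀

  -- V x n = 2 T_{n+1}(x/2), with T the Chebyshev polynomials of the first kind.
  V : ℤ → ℕ → ℤ
  V x n = U x (suc (suc n)) - U x n

  U-double : ∀ x a → U x (suc (suc (a ℕ.+ a))) ≡ U x (suc a) * V x a
  U-double x a = begin
      U x (suc (suc (a ℕ.+ a)))
    ≡⟨ cong (U x ∘ suc) (ℕ.+-suc a a) ⟨
      U x (suc (a ℕ.+ suc a))
    ≡⟨ U-+ x a (suc a) ⟩
      U x (suc a) * U x (suc (suc a)) - U x a * U x (suc a)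
    ≡⟨ factor (U x (suc a)) (U x (suc (suc a))) (U x a) ⟩
      U x (suc a) * (U x (suc (suc a)) - U x a)
    ∎
    where
    factor : ∀ p q r → p * q - r * p ≡ p * (q - r)
    factor = solve-∀

  record PathVertex (f : ℕ → ℕ → ℤ) (x : ℤ) (v : ℕ) : Set where
    field
      diagonal : f v v ≡ x
      link     : f v (suc v) * f (suc v) v ≡ 1ℤ
      column   : ∀ j → suc v ℕ.< j → f j v ≡ 0ℤ
      row      : ∀ j → suc v ℕ.< j → f v j ≡ 0ℤ

  principalMinor-pathVertex : ∀ f x d n → PathVertex f x d →
    principalMinor f d (suc (suc n)) ≡ x * principalMinor f (suc d) (suc n) - principalMinor f (suc (suc d)) n
  principalMinor-pathVertex f x d n v = begin
      principalMinor f d (suc (suc n))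
    ≡⟨ principalMinor-pendant f d n column row ⟩
      f d d * principalMinor f (suc d) (suc n) - f d (suc d) * f (suc d) d * principalMinor f (suc (suc d)) n
    ≡⟨ cong₂ (λ a b → a * principalMinor f (suc d) (suc n) - b * principalMinor f (suc (suc d)) n) diagonal link ⟩
      x * principalMinor f (suc d) (suc n) - 1ℤ * principalMinor f (suc (suc d)) n
    ≡⟨ cong (λ e → x * principalMinor f (suc d) (suc n) - e) (*-identityˡ _) ⟩
      x * principalMinor f (suc d) (suc n) - principalMinor f (suc (suc d)) n
    ∎
    where open PathVertex v

  principalMinor-pathSegment : ∀ f x d L s → (∀ i → i ℕ.< L → PathVertex f x (i ℕ.+ d)) →
    principalMinor f d (L ℕ.+ suc s) ≡
      U x (suc L) * principalMinor f (L ℕ.+ d) (suc s) - U x L * principalMinor f (suc (L ℕ.+ d)) s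
  principalMinor-pathSegment f x d zero s _ = start (principalMinor f d (suc s)) (principalMinor f (suc d) s)
    where
    start : ∀ a b → a ≡ 1ℤ * a - 0ℤ * b
    start = solve-∀
  principalMinor-pathSegment f x d (suc L) s path = begin
      principalMinor f d (suc L ℕ.+ suc s)
    ≡⟨ cong (principalMinor f d) (ℕ.+-suc L (suc s)) ⟨
      principalMinor f d (L ℕ.+ suc (suc s))
    ≡⟨ principalMinor-pathSegment f x d L (suc s) (λ i i<L → path i (ℕ.m<n⇒m<1+n i<L)) ⟩
      U x (suc L) * principalMinor f v (suc (suc s)) - U x L * A
    ≡⟨ cong (λ e → U x (suc L) * e - U x L * A) (principalMinor-pathVertex f x v s (path L ℕ.≤-refl)) ⟩
      U x (suc L) * (x * A - B) - U x L * A
    ≡⟨ regroup x (U x (suc L)) (U x L) A B ⟩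
      U x (suc (suc L)) * A - U x (suc L) * B
    ∎
    where
    v = L ℕ.+ d
    A = principalMinor f (suc v) (suc s)
    B = principalMinor f (suc (suc v)) s
    regroup : ∀ x p q a b → p * (x * a - b) - q * a ≡ (x * p - q) * a - p * b
    regroup = solve-∀

  principalMinor-pathComponent : ∀ f x d L s → (∀ i → i ℕ.< L → PathVertex f x (i ℕ.+ d)) →
    f (L ℕ.+ d) (L ℕ.+ d) ≡ x → (∀ j → L ℕ.+ d ℕ.< j → f j (L ℕ.+ d) ≡ 0ℤ) →
    principalMinor f d (L ℕ.+ suc s) ≡ U x (suc (suc L)) * principalMinor f (suc (L ℕ.+ d)) s
  principalMinor-pathComponent f x d L s path diagonal column = begin
      principalMinor f d (L ℕ.+ suc s)
    ≡⟨ principalMinor-pathSegment f x d L s path ⟩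
      U x (suc L) * principalMinor f (L ℕ.+ d) (suc s) - U x L * B
    ≡⟨ cong (λ e → U x (suc L) * e - U x L * B) (principalMinor-isolated f (L ℕ.+ d) s column) ⟩
      U x (suc L) * (f (L ℕ.+ d) (L ℕ.+ d) * B) - U x L * B
    ≡⟨ cong (λ e → U x (suc L) * (e * B) - U x L * B) diagonal ⟩
      U x (suc L) * (x * B) - U x L * B
    ≡⟨ regroup x (U x (suc L)) (U x L) B ⟩
      U x (suc (suc L)) * B
    ∎
    where
    B = principalMinor f (suc (L ℕ.+ d)) s
    regroup : ∀ x p q b → p * (x * b) - q * b ≡ (x * p - q) * b
    regroup = solve-∀

  principalMinor-translate : ∀ f h a N → (∀ i j → i ℕ.< N → j ℕ.< N → f (i ℕ.+ a) (j ℕ.+ a) ≡ h i j) →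
                             ∀ s n → s ℕ.+ n ℕ.≤ N → principalMinor f (s ℕ.+ a) n ≡ principalMinor h s n
  principalMinor-translate f h a N f≡h s n s+n≤N = det-cong n λ r c →
    trans (cong₂ f (sym (ℕ.+-assoc (toℕ r) s a)) (sym (ℕ.+-assoc (toℕ c) s a))) (f≡h _ _ (inWindow r) (inWindow c))
    where
    inWindow : ∀ (r : Fin n) → toℕ r ℕ.+ s ℕ.< N
    inWindow r = ℕ.<-≤-trans (ℕ.+-monoˡ-< s (Fin.toℕ<n r)) (subst (ℕ._≤ N) (ℕ.+-comm s n) s+n≤N)

open PrincipalMinors

module SignedGraphsOnℕ where

  open import Data.Bool using (true; false; if_then_else_; _∨_)
  open import Data.Bool.Properties using (∨-comm)
  open import Data.List using (List; []; _∷_; map)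
  open import Data.Maybe using (Maybe; just; nothing)
  open import Data.Product using (_×_; _,_; map₁)
  open import Data.Sign using (Sign)
  open import Relation.Binary.Definitions using (tri<; tri≈; tri>)
  open import Relation.Nullary using (yes; no)
  open import Relation.Nullary.Decidable using (dec-true; dec-false)
  open ≡-Reasoning

  -- A signed graph on ℕ is presented by listing, for every vertex i, its neighbours j > i
  -- together with the signs of the edges ij.
  Presentation : Set
  Presentation = ℕ → List (ℕ × Sign)

  lookupSign : ℕ → List (ℕ × Sign) → Maybe Sign
  lookupSign j []             = nothing
  lookupSign j ((w , s) ∷ es) with j ℕ.≟ w
  ... | yes _ = just s
  ... | no  _ = lookupSign j es

  edgeOf : Presentation → ℕ → ℕ → Maybe Sign
  edgeOf F i j with ℕ.<-cmp i j
  ... | tri< _ _ _ = lookupSign j (F i)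
  ... | tri≈ _ _ _ = nothing
  ... | tri> _ _ _ = lookupSign i (F j)

  edgeOf-< : ∀ F {i j} → i ℕ.< j → edgeOf F i j ≡ lookupSign j (F i)
  edgeOf-< F {i} {j} i<j with ℕ.<-cmp i j
  ... | tri< _ _ _   = refl
  ... | tri≈ i≮j _ _ = contradiction i<j i≮j
  ... | tri> i≮j _ _ = contradiction i<j i≮j

  edgeOf-> : ∀ F {i j} → i ℕ.< j → edgeOf F j i ≡ lookupSign j (F i)
  edgeOf-> F {i} {j} i<j with ℕ.<-cmp j i
  ... | tri< j<i _ _ = contradiction i<j (ℕ.<⇒≯ j<i)
  ... | tri≈ _ j≡i _ = contradiction (sym j≡i) (ℕ.<⇒≢ i<j)
  ... | tri> _ _ _   = refl

  edgeOf-loop : ∀ F i → edgeOf F i i ≡ nothing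
  edgeOf-loop F i with ℕ.<-cmp i i
  ... | tri< i<i _ _ = contradiction i<i (ℕ.<-irrefl refl)
  ... | tri≈ _ _ _   = refl
  ... | tri> _ _ i<i = contradiction i<i (ℕ.<-irrefl refl)

  edgeOf-sym : ∀ F i j → edgeOf F i j ≡ edgeOf F j i
  edgeOf-sym F i j with ℕ.<-cmp i j
  ... | tri< i<j _ _ = sym (edgeOf-> F i<j)
  ... | tri≈ _ refl _ = sym (edgeOf-loop F i)
  ... | tri> _ _ j<i = sym (edgeOf-< F j<i)

  signedGraph : Presentation → (n : ℕ) → SignedGraph n
  signedGraph F n = record
    { edge      = λ i j → edgeOf F (toℕ i) (toℕ j)
    ; symmetric = λ i j → edgeOf-sym F (toℕ i) (toℕ j)
    ; loopless  = λ i → edgeOf-loop F (toℕ i)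
    }

  lookupSign-here : ∀ w s es → lookupSign w ((w , s) ∷ es) ≡ just s
  lookupSign-here w s es with w ℕ.≟ w
  ... | yes _   = refl
  ... | no  w≢w = contradiction refl w≢w

  lookupSign-there : ∀ {j w} s es → j ≢ w → lookupSign j ((w , s) ∷ es) ≡ lookupSign j es
  lookupSign-there {j} {w} s es j≢w with j ℕ.≟ w
  ... | yes j≡w = contradiction j≡w j≢w
  ... | no  _   = refl

  isolatedAbove : ∀ F {v} → F v ≡ [] → ∀ j → v ℕ.< j → edgeOf F j v ≡ nothing
  isolatedAbove F {v} Fv≡[] j v<j = trans (edgeOf-> F v<j) (cong (lookupSign j) Fv≡[])

  module _ (F : Presentation) {v w : ℕ} {s : Sign} (single : F v ≡ (w , s) ∷ []) where

    pendantAbove-edge : v ℕ.< w → edgeOf F v w ≡ just s × edgeOf F w v ≡ just s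
    pendantAbove-edge v<w =
      trans (edgeOf-< F v<w) lookup , trans (edgeOf-> F v<w) lookup
      where
      lookup : lookupSign w (F v) ≡ just s
      lookup = trans (cong (lookupSign w) single) (lookupSign-here w s [])

    pendantAbove-nonEdge : ∀ j → v ℕ.< j → j ≢ w → edgeOf F j v ≡ nothing × edgeOf F v j ≡ nothing
    pendantAbove-nonEdge j v<j j≢w =
      trans (edgeOf-> F v<j) lookup , trans (edgeOf-< F v<j) lookup
      where
      lookup : lookupSign j (F v) ≡ nothing
      lookup = trans (cong (lookupSign j) single) (lookupSign-there s [] j≢w)

  ≡ᵇ-refl : ∀ n → (n ℕ.≡ᵇ n) ≡ true
  ≡ᵇ-refl n = dec-true (n ℕ.≟ n) refl

  ≡ᵇ-≢ : ∀ {m n} → m ≢ n → (m ℕ.≡ᵇ n) ≡ false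
  ≡ᵇ-≢ {m} {n} m≢n = dec-false (m ℕ.≟ n) m≢n

  pathPresentation : Presentation
  pathPresentation i = (suc i , Sign.+) ∷ []

  pathEdge-above : ∀ {i j} → i ℕ.< j →
                   (if consecutive i j then just Sign.+ else nothing) ≡ lookupSign j (pathPresentation i)
  pathEdge-above {i} {j} i<j with j ℕ.≟ suc i
  ... | yes refl = cong (if_then just Sign.+ else nothing)
                        (cong₂ _∨_ (≡ᵇ-≢ (ℕ.<⇒≢ (ℕ.<-trans i<j (ℕ.n<1+n j)))) (≡ᵇ-refl i))
  ... | no j≢i+1 = cong (if_then just Sign.+ else nothing)
                        (cong₂ _∨_ (≡ᵇ-≢ (ℕ.<⇒≢ (ℕ.<-trans i<j (ℕ.n<1+n j)))) (≡ᵇ-≢ j≢i+1))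

  pathEdge-edgeOf : ∀ i j → (if consecutive i j then just Sign.+ else nothing) ≡ edgeOf pathPresentation i j
  pathEdge-edgeOf i j with ℕ.<-cmp i j
  -- matching on ℕ.<-cmp i j also unfolds the right-hand side edgeOf pathPresentation i j
  ... | tri< i<j _ _ = pathEdge-above i<j
  ... | tri≈ _ refl _ = cong (if_then just Sign.+ else nothing)
                             (cong₂ _∨_ (≡ᵇ-≢ (ℕ.<⇒≢ (ℕ.n<1+n i))) (≡ᵇ-≢ (ℕ.<⇒≢ (ℕ.n<1+n i))))
  ... | tri> _ _ j<i = trans (cong (if_then just Sign.+ else nothing) (∨-comm (i ℕ.≡ᵇ suc j) (j ℕ.≡ᵇ suc i)))
                             (pathEdge-above j<i)

  shift : ℕ → List (ℕ × Sign) → List (ℕ × Sign)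
  shift a = map (map₁ (ℕ._+ a))

  lookupSign-shift : ∀ a j es → lookupSign (j ℕ.+ a) (shift a es) ≡ lookupSign j es
  lookupSign-shift a j []             = refl
  lookupSign-shift a j ((w , s) ∷ es) with j ℕ.+ a ℕ.≟ w ℕ.+ a | j ℕ.≟ w
  ... | yes _   | yes _   = refl
  ... | no  _   | no  _   = lookupSign-shift a j es
  ... | yes j+a≡w+a | no j≢w = contradiction (ℕ.+-cancelʳ-≡ a j w j+a≡w+a) j≢w
  ... | no j+a≢w+a  | yes j≡w = contradiction (cong (ℕ._+ a) j≡w) j+a≢w+a

  edgeOf-translate : ∀ F Q a N → (∀ i → suc i ℕ.< N → F (i ℕ.+ a) ≡ shift a (Q i)) →
                     ∀ i j → i ℕ.< N → j ℕ.< N → edgeOf F (i ℕ.+ a) (j ℕ.+ a) ≡ edgeOf Q i j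
  edgeOf-translate F Q a N F≡Q i j i<N j<N with ℕ.<-cmp i j
  -- matching on ℕ.<-cmp i j also unfolds the right-hand side edgeOf Q i j
  ... | tri< i<j _ _ = begin
      edgeOf F (i ℕ.+ a) (j ℕ.+ a)         ≡⟨ edgeOf-< F (ℕ.+-monoˡ-< a i<j) ⟩
      lookupSign (j ℕ.+ a) (F (i ℕ.+ a))   ≡⟨ cong (lookupSign (j ℕ.+ a)) (F≡Q i (ℕ.≤-<-trans i<j j<N)) ⟩
      lookupSign (j ℕ.+ a) (shift a (Q i)) ≡⟨ lookupSign-shift a j (Q i) ⟩
      lookupSign j (Q i)                   ∎
  ... | tri≈ _ refl _ = edgeOf-loop F (i ℕ.+ a)
  ... | tri> _ _ j<i = begin
      edgeOf F (i ℕ.+ a) (j ℕ.+ a)         ≡⟨ edgeOf-> F (ℕ.+-monoˡ-< a j<i) ⟩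
      lookupSign (i ℕ.+ a) (F (j ℕ.+ a))   ≡⟨ cong (lookupSign (i ℕ.+ a)) (F≡Q j (ℕ.≤-<-trans j<i i<N)) ⟩
      lookupSign (i ℕ.+ a) (shift a (Q j)) ≡⟨ lookupSign-shift a i (Q j) ⟩
      lookupSign i (Q j)                   ∎

open SignedGraphsOnℕ

module CharacteristicMatrices where

  open import Data.Integer using (ℤ; 0ℤ; 1ℤ; -_; _*_; _-_)
  open import Data.Integer.Tactic.RingSolver using (solve-∀)
  open import Data.Bool using (if_then_else_)
  open import Data.List using ([]; _∷_)
  open import Data.Maybe using (Maybe; just; nothing)
  open import Data.Product using (_×_; _,_; proj₁; proj₂)
  open import Data.Sign using (Sign)
  open import Relation.Nullary using (yes; no)
  open ≡-Reasoning

  entry : Maybe Sign → ℤ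
  entry nothing  = 0ℤ
  entry (just s) = signValue s

  δ : ℕ → ℕ → ℤ
  δ i j = if i ℕ.≡ᵇ j then 1ℤ else 0ℤ

  charMatrix : ℤ → (ℕ → ℕ → Maybe Sign) → ℕ → ℕ → ℤ
  charMatrix x g i j = x * δ i j - entry (g i j)

  identity-δ : ∀ {n} (i j : Fin n) → identity i j ≡ δ (toℕ i) (toℕ j)
  identity-δ zero    zero    = refl
  identity-δ zero    (suc j) = refl
  identity-δ (suc i) zero    = refl
  identity-δ (suc i) (suc j) = identity-δ i j

  adjacency-entry : ∀ {n} (Γ : SignedGraph n) i j → adjacency Γ i j ≡ entry (edge Γ i j)
  adjacency-entry Γ i j with edge Γ i j
  ... | nothing = refl
  ... | just _  = refl

  charPoly-principalMinor : ∀ {n} (Γ : SignedGraph n) g → (∀ i j → edge Γ i j ≡ g (toℕ i) (toℕ j)) →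
                            ∀ x → charPoly Γ x ≡ principalMinor (charMatrix x g) 0 n
  charPoly-principalMinor {n} Γ g edge≗g x = det-cong n λ i j →
    trans (cong₂ (λ e a → x * e - a) (identity-δ i j) (trans (adjacency-entry Γ i j) (cong entry (edge≗g i j))))
          (cong₂ (charMatrix x g) (sym (ℕ.+-identityʳ (toℕ i))) (sym (ℕ.+-identityʳ (toℕ j))))

  δ-diagonal : ∀ v → δ v v ≡ 1ℤ
  δ-diagonal v = cong (if_then 1ℤ else 0ℤ) (≡ᵇ-refl v)

  δ-offDiagonal : ∀ {i j} → i ≢ j → δ i j ≡ 0ℤ
  δ-offDiagonal i≢j = cong (if_then 1ℤ else 0ℤ) (≡ᵇ-≢ i≢j)

  charMatrix-diagonal : ∀ x g v → g v v ≡ nothing → charMatrix x g v v ≡ x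
  charMatrix-diagonal x g v loopless = begin
      x * δ v v - entry (g v v)   ≡⟨ cong₂ (λ e a → x * e - entry a) (δ-diagonal v) loopless ⟩
      x * 1ℤ - 0ℤ                 ≡⟨ solve x ⟩
      x                           ∎
    where
    solve : ∀ x → x * 1ℤ - 0ℤ ≡ x
    solve = solve-∀

  charMatrix-offDiagonal : ∀ x g {i j} → i ≢ j → charMatrix x g i j ≡ - entry (g i j)
  charMatrix-offDiagonal x g {i} {j} i≢j =
    trans (cong (λ e → x * e - entry (g i j)) (δ-offDiagonal i≢j)) (solve x (entry (g i j)))
    where
    solve : ∀ x e → x * 0ℤ - e ≡ - e
    solve = solve-∀

  charMatrix-nonEdge : ∀ x g {i j} → i ≢ j → g i j ≡ nothing → charMatrix x g i j ≡ 0ℤ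
  charMatrix-nonEdge x g i≢j nonEdge = trans (charMatrix-offDiagonal x g i≢j) (cong (λ e → - entry e) nonEdge)

  charMatrix-link : ∀ x g {i j s} → i ≢ j → g i j ≡ just s → g j i ≡ just s →
                    charMatrix x g i j * charMatrix x g j i ≡ 1ℤ
  charMatrix-link x g {i} {j} {s} i≢j ij ji =
    trans (cong₂ _*_ (trans (charMatrix-offDiagonal x g i≢j) (cong (λ e → - entry e) ij))
                     (trans (charMatrix-offDiagonal x g (i≢j ∘ sym)) (cong (λ e → - entry e) ji)))
          (sign² s)
    where
    sign² : ∀ s → - signValue s * - signValue s ≡ 1ℤ
    sign² Sign.+ = refl
    sign² Sign.- = refl

  pathVertex : ∀ F x {v} → F v ≡ (suc v , Sign.+) ∷ [] → PathVertex (charMatrix x (edgeOf F)) x v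
  pathVertex F x {v} single = record
    { diagonal = charMatrix-diagonal x (edgeOf F) v (edgeOf-loop F v)
    ; link     = charMatrix-link x (edgeOf F) (ℕ.<⇒≢ (ℕ.n<1+n v)) (proj₁ link) (proj₂ link)
    ; column   = λ j v+1<j → charMatrix-nonEdge x (edgeOf F) (far v+1<j ∘ sym) (proj₁ (nonEdge j v+1<j))
    ; row      = λ j v+1<j → charMatrix-nonEdge x (edgeOf F) (far v+1<j) (proj₂ (nonEdge j v+1<j))
    }
    where
    link = pendantAbove-edge F single (ℕ.n<1+n v)
    nonEdge : ∀ j → suc v ℕ.< j → edgeOf F j v ≡ nothing × edgeOf F v j ≡ nothing
    nonEdge j v+1<j = pendantAbove-nonEdge F single j (ℕ.<-trans (ℕ.n<1+n v) v+1<j) (ℕ.>⇒≢ v+1<j)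
    far : ∀ {j} → suc v ℕ.< j → v ≢ j
    far v+1<j = ℕ.<⇒≢ (ℕ.<-trans (ℕ.n<1+n _) v+1<j)

  charPoly-path : ∀ n x → charPoly (path n) x ≡ U x (suc n)
  charPoly-path n x =
    trans (charPoly-principalMinor (path n) (edgeOf pathPresentation) (λ i j → pathEdge-edgeOf (toℕ i) (toℕ j)) x)
                            (principalMinor-path n)
    where
    f = charMatrix x (edgeOf pathPresentation)
    principalMinor-path : ∀ n → principalMinor f 0 n ≡ U x (suc n)
    principalMinor-path zero    = refl
    principalMinor-path (suc n) = begin
        principalMinor f 0 (suc n)
      ≡⟨ cong (principalMinor f 0) (ℕ.+-comm 1 n) ⟩
        principalMinor f 0 (n ℕ.+ 1)
      ≡⟨ principalMinor-pathSegment f x 0 n 0 (λ i _ → pathVertex pathPresentation x {i ℕ.+ 0} refl) ⟩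
        U x (suc n) * principalMinor f (n ℕ.+ 0) 1 - U x n * 1ℤ
      ≡⟨ cong (λ e → U x (suc n) * e - U x n * 1ℤ)
              (trans (principalMinor-one f (n ℕ.+ 0)) (PathVertex.diagonal (pathVertex pathPresentation x {n ℕ.+ 0} refl))) ⟩
        U x (suc n) * x - U x n * 1ℤ
      ≡⟨ solve x (U x (suc n)) (U x n) ⟩
        U x (suc (suc n))
      ∎
      where
      solve : ∀ x p q → p * x - q * 1ℤ ≡ x * p - q
      solve = solve-∀

  δ-translate : ∀ a i j → δ (i ℕ.+ a) (j ℕ.+ a) ≡ δ i j
  δ-translate a i j with i ℕ.≟ j
  ... | yes refl = trans (δ-diagonal (i ℕ.+ a)) (sym (δ-diagonal i))
  ... | no i≢j   = trans (δ-offDiagonal (i≢j ∘ ℕ.+-cancelʳ-≡ a i j)) (sym (δ-offDiagonal i≢j))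

open CharacteristicMatrices

module SymbolicDeterminants where

  open import Data.Integer using (ℤ; +_; 0ℤ; 1ℤ; _+_; _*_; _-_)
  open import Data.Integer.Solver using (module +-*-Solver)
  open +-*-Solver using (Polynomial; con; var; _:+_; _:*_; _:-_; ⟦_⟧; prove)
  open import Data.List using ([]; _∷_)
  open import Data.Maybe using (Maybe)
  open import Data.Product using (_,_)
  open import Data.Sign using (Sign)
  open import Data.Vec using (Vec)

  -- det on the ring solver's polynomial syntax: a fixed small determinant whose entries involve an
  -- indeterminate x then becomes a polynomial identity that the solver decides by normalisation.
  sumᴾ : ∀ {k} n → (Fin n → Polynomial k) → Polynomial k
  sumᴾ zero    p = con 0ℤ
  sumᴾ (suc n) p = p zero :+ sumᴾ n (p ∘ suc)

  detᴾ : ∀ {k} n → (Fin n → Fin n → Polynomial k) → Polynomial k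
  cofactorᴾ : ∀ {k} n → (Fin (suc n) → Fin (suc n) → Polynomial k) → Fin (suc n) → Polynomial k

  detᴾ zero    P = con 1ℤ
  detᴾ (suc n) P = sumᴾ (suc n) (cofactorᴾ n P)

  cofactorᴾ n P j = con (altSign (toℕ j)) :* (P zero j :* detᴾ n (λ r c → P (suc r) (punchIn j c)))

  ⟦sumᴾ⟧ : ∀ {k} n (p : Fin n → Polynomial k) ρ → ⟦ sumᴾ n p ⟧ ρ ≡ sumFin n (λ j → ⟦ p j ⟧ ρ)
  ⟦sumᴾ⟧ zero    p ρ = refl
  ⟦sumᴾ⟧ (suc n) p ρ = cong (λ s → ⟦ p zero ⟧ ρ + s) (⟦sumᴾ⟧ n (p ∘ suc) ρ)

  ⟦detᴾ⟧ : ∀ {k} n (P : Fin n → Fin n → Polynomial k) ρ → ⟦ detᴾ n P ⟧ ρ ≡ det n (λ r c → ⟦ P r c ⟧ ρ)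
  ⟦detᴾ⟧ zero    P ρ = refl
  ⟦detᴾ⟧ (suc n) P ρ = trans (⟦sumᴾ⟧ (suc n) (cofactorᴾ n P) ρ) (sumFin-cong (suc n) λ j →
    cong (λ d → altSign (toℕ j) * (⟦ P zero j ⟧ ρ * d)) (⟦detᴾ⟧ n (λ r c → P (suc r) (punchIn j c)) ρ))

  charMatrixᴾ : (ℕ → ℕ → Maybe Sign) → ℕ → ℕ → Polynomial 1
  charMatrixᴾ g i j = var zero :* con (δ i j) :- con (entry (g i j))

  principalMinorᴾ : (ℕ → ℕ → Maybe Sign) → ℕ → (n : ℕ) → Polynomial 1
  principalMinorᴾ g d n = detᴾ n (λ r c → charMatrixᴾ g (toℕ r ℕ.+ d) (toℕ c ℕ.+ d))

  principalMinor-symbolic : ∀ g d n x → principalMinor (charMatrix x g) d n ≡ ⟦ principalMinorᴾ g d n ⟧ (x Vec.∷ Vec.[])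
  principalMinor-symbolic g d n x = sym (⟦detᴾ⟧ n _ (x Vec.∷ Vec.[]))

  negativeQuadrangle : Presentation
  negativeQuadrangle 0 = (1 , Sign.+) ∷ (2 , Sign.-) ∷ []
  negativeQuadrangle 1 = (3 , Sign.+) ∷ []
  negativeQuadrangle 2 = (3 , Sign.+) ∷ []
  negativeQuadrangle _ = []

  module _ (x : ℤ) where

    private
      Q = edgeOf negativeQuadrangle
      X : Polynomial 1
      X = var zero

    negativeQuadrangle-0-4 : principalMinor (charMatrix x Q) 0 4 ≡ (x * x - + 2) * (x * x - + 2)
    negativeQuadrangle-0-4 = trans (principalMinor-symbolic Q 0 4 x)
      (prove (x Vec.∷ Vec.[]) (principalMinorᴾ Q 0 4) ((X :* X :- con (+ 2)) :* (X :* X :- con (+ 2))) refl)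

    negativeQuadrangle-1-3 : principalMinor (charMatrix x Q) 1 3 ≡ x * x * x - + 2 * x
    negativeQuadrangle-1-3 = trans (principalMinor-symbolic Q 1 3 x)
      (prove (x Vec.∷ Vec.[]) (principalMinorᴾ Q 1 3) (X :* X :* X :- con (+ 2) :* X) refl)

    negativeQuadrangle-0-3 : principalMinor (charMatrix x Q) 0 3 ≡ x * x * x - + 2 * x
    negativeQuadrangle-0-3 = trans (principalMinor-symbolic Q 0 3 x)
      (prove (x Vec.∷ Vec.[]) (principalMinorᴾ Q 0 3) (X :* X :* X :- con (+ 2) :* X) refl)

    negativeQuadrangle-1-2 : principalMinor (charMatrix x Q) 1 2 ≡ x * x
    negativeQuadrangle-1-2 = trans (principalMinor-symbolic Q 1 2 x)
      (prove (x Vec.∷ Vec.[]) (principalMinorᴾ Q 1 2) (X :* X) refl)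

open SymbolicDeterminants

module BranchVertices where

  open import Data.Bool using (true; false; T)
  open import Data.Bool.Properties using (T-∨)
  open import Data.Maybe using (nothing)
  open import Data.Product using (_,_)
  open import Data.Sum as Sum using (_⊎_; inj₁; inj₂; [_,_]′)
  open import Data.Unit using (tt)
  open import Function.Bundles using (Inverse; Equivalence)

  record BranchVertex {n} (Γ : SignedGraph n) : Set where
    field
      centre     : Fin n
      u₁ u₂ u₃   : Fin n
      adjacent₁  : edge Γ centre u₁ ≢ nothing
      adjacent₂  : edge Γ centre u₂ ≢ nothing
      adjacent₃  : edge Γ centre u₃ ≢ nothing
      u₁≢u₂      : u₁ ≢ u₂
      u₁≢u₃      : u₁ ≢ u₃
      u₂≢u₃      : u₂ ≢ u₃

  switchEdge-nothing : ∀ b e → switchEdge b e ≡ nothing → e ≡ nothing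
  switchEdge-nothing b nothing _ = refl

  branchVertex-transport : ∀ {n} {Γ Δ : SignedGraph n} → SwitchingIsomorphic Γ Δ → BranchVertex Γ → BranchVertex Δ
  branchVertex-transport {Γ = Γ} {Δ} (X , π , switched) β = record
    { centre    = from centre
    ; u₁        = from u₁
    ; u₂        = from u₂
    ; u₃        = from u₃
    ; adjacent₁ = adjacent₁ ∘ reflect u₁
    ; adjacent₂ = adjacent₂ ∘ reflect u₂
    ; adjacent₃ = adjacent₃ ∘ reflect u₃
    ; u₁≢u₂     = u₁≢u₂ ∘ from-injective
    ; u₁≢u₃     = u₁≢u₃ ∘ from-injective
    ; u₂≢u₃     = u₂≢u₃ ∘ from-injective
    }
    where
    open BranchVertex β
    open Inverse π using (to; from)
    to∘from : ∀ v → to (from v) ≡ v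
    to∘from = Inverse.strictlyInverseˡ π
    from-injective : ∀ {v w} → from v ≡ from w → v ≡ w
    from-injective {v} {w} eq = trans (sym (to∘from v)) (trans (cong to eq) (to∘from w))
    reflect : ∀ u → edge Δ (from centre) (from u) ≡ nothing → edge Γ centre u ≡ nothing
    reflect u nonEdge = subst₂ (λ v w → edge Γ v w ≡ nothing) (to∘from centre) (to∘from u)
      (switchEdge-nothing _ _ (trans (switched (from centre) (from u)) nonEdge))

  NextTo : ℕ → ℕ → Set
  NextTo t p = t ≡ suc p ⊎ p ≡ suc t

  path-adjacent⇒consecutive : ∀ {n} (v u : Fin n) → edge (path n) v u ≢ nothing → T (consecutive (toℕ v) (toℕ u))
  path-adjacent⇒consecutive v u adjacent with consecutive (toℕ v) (toℕ u)
  ... | true  = tt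
  ... | false = contradiction refl adjacent

  path-nextTo : ∀ {n} (v u : Fin n) → edge (path n) v u ≢ nothing → NextTo (toℕ v) (toℕ u)
  path-nextTo v u adjacent = Sum.map (ℕ.≡ᵇ⇒≡ _ _) (ℕ.≡ᵇ⇒≡ _ _)
    (Equivalence.to (T-∨ {toℕ v ℕ.≡ᵇ suc (toℕ u)}) (path-adjacent⇒consecutive v u adjacent))

  nextTo-pigeonhole : ∀ {t p q r} → NextTo t p → NextTo t q → NextTo t r → p ≡ q ⊎ p ≡ r ⊎ q ≡ r
  nextTo-pigeonhole (inj₁ refl) (inj₁ t≡q+1) _            = inj₁ (ℕ.suc-injective t≡q+1)
  nextTo-pigeonhole (inj₂ refl) (inj₂ q≡t+1) _            = inj₁ (sym q≡t+1)
  nextTo-pigeonhole (inj₁ refl) (inj₂ _)     (inj₁ t≡r+1) = inj₂ (inj₁ (ℕ.suc-injective t≡r+1))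
  nextTo-pigeonhole (inj₁ _)    (inj₂ refl)  (inj₂ r≡t+1) = inj₂ (inj₂ (sym r≡t+1))
  nextTo-pigeonhole (inj₂ _)    (inj₁ refl)  (inj₁ t≡r+1) = inj₂ (inj₂ (ℕ.suc-injective t≡r+1))
  nextTo-pigeonhole (inj₂ refl) (inj₁ _)     (inj₂ r≡t+1) = inj₂ (inj₁ (sym r≡t+1))

  path-noBranchVertex : ∀ n → ¬ BranchVertex (path n)
  path-noBranchVertex n β =
    [ u₁≢u₂ ∘ Fin.toℕ-injective , [ u₁≢u₃ ∘ Fin.toℕ-injective , u₂≢u₃ ∘ Fin.toℕ-injective ]′ ]′
      (nextTo-pigeonhole (path-nextTo centre u₁ adjacent₁) (path-nextTo centre u₂ adjacent₂)
                         (path-nextTo centre u₃ adjacent₃))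
    where open BranchVertex β

open BranchVertices

module Construction (m : ℕ) where

  open import Data.Integer using (ℤ; +_; 0ℤ; 1ℤ; _*_; _-_)
  open import Data.Integer.Properties using (*-identityˡ; *-assoc)
  open import Data.Integer.Tactic.RingSolver using (solve-∀)
  import Data.Nat.Tactic.RingSolver as ℕ-RingSolver
  open import Data.List using ([]; _∷_)
  open import Data.Maybe using (just; nothing)
  open import Data.Product using (_×_; _,_; proj₁; proj₂)
  open import Data.Sign using (Sign)
  open import Relation.Nullary using (yes; no)
  open import Relation.Nullary.Decidable using (dec-no)
  open ≡-Reasoning

  -- With k = m + 1, Γ is the path 0, …, m together with a component H on m + 1, …, c: the negative
  -- quadrangle a, a + 1, c, a + 2 (only its edge a (a + 2) is negative), the path m + 1, …, b₁ with b₁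
  -- joined to c, and the path b₁ + 1, …, a − 1 ending at a.
  b₁ a c : ℕ
  b₁ = suc (m ℕ.+ m) ℕ.+ suc m
  a  = m ℕ.+ suc b₁
  c  = 3 ℕ.+ a

  above : Presentation
  above i with i ℕ.≟ m | i ℕ.≟ b₁ | i ℕ.≟ a | i ℕ.≟ suc a
  ... | yes _ | _     | _     | _     = []
  ... | no _  | yes _ | _     | _     = (c , Sign.+) ∷ []
  ... | no _  | no _  | yes _ | _     = (suc a , Sign.+) ∷ (suc (suc a) , Sign.-) ∷ []
  ... | no _  | no _  | no _  | yes _ = (c , Sign.+) ∷ []
  ... | no _  | no _  | no _  | no _  = (suc i , Sign.+) ∷ []

  n : ℕ
  n = 4 ℕ.* suc m ℕ.+ 3

  Γ : SignedGraph n
  Γ = signedGraph above n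

  m<b₁ : m ℕ.< b₁
  m<b₁ = ℕ.m≤n+m (suc m) (suc (m ℕ.+ m))

  b₁<a : b₁ ℕ.< a
  b₁<a = ℕ.m≤n+m (suc b₁) m

  m<a : m ℕ.< a
  m<a = ℕ.<-trans m<b₁ b₁<a

  a<a+1 : a ℕ.< suc a
  a<a+1 = ℕ.n<1+n a

  a+1<a+2 : suc a ℕ.< suc (suc a)
  a+1<a+2 = ℕ.n<1+n (suc a)

  a+2<c : suc (suc a) ℕ.< c
  a+2<c = ℕ.n<1+n (suc (suc a))

  a+1<c : suc a ℕ.< c
  a+1<c = ℕ.<-trans a+1<a+2 a+2<c

  b₁<c : b₁ ℕ.< c
  b₁<c = ℕ.<-trans (ℕ.<-trans b₁<a a<a+1) a+1<c

  above-m : above m ≡ []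
  above-m rewrite ℕ.≟-diag (refl {x = m}) = refl

  above-b₁ : above b₁ ≡ (c , Sign.+) ∷ []
  above-b₁ rewrite dec-no (b₁ ℕ.≟ m) (ℕ.>⇒≢ m<b₁) | ℕ.≟-diag (refl {x = b₁}) = refl

  above-a : above a ≡ (suc a , Sign.+) ∷ (suc (suc a) , Sign.-) ∷ []
  above-a
    rewrite dec-no (a ℕ.≟ m) (ℕ.>⇒≢ m<a) | dec-no (a ℕ.≟ b₁) (ℕ.>⇒≢ b₁<a) | ℕ.≟-diag (refl {x = a})
    = refl

  above-a+1 : above (suc a) ≡ (c , Sign.+) ∷ []
  above-a+1
    rewrite dec-no (suc a ℕ.≟ m) (ℕ.>⇒≢ (ℕ.<-trans m<a a<a+1))
          | dec-no (suc a ℕ.≟ b₁) (ℕ.>⇒≢ (ℕ.<-trans b₁<a a<a+1))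
          | dec-no (suc a ℕ.≟ a) (ℕ.>⇒≢ a<a+1) | ℕ.≟-diag (refl {x = suc a})
    = refl

  above-ordinary : ∀ {v} → v ≢ m → v ≢ b₁ → v ≢ a → v ≢ suc a → above v ≡ (suc v , Sign.+) ∷ []
  above-ordinary {v} v≢m v≢b₁ v≢a v≢a+1
    rewrite dec-no (v ℕ.≟ m) v≢m | dec-no (v ℕ.≟ b₁) v≢b₁
          | dec-no (v ℕ.≟ a) v≢a | dec-no (v ℕ.≟ suc a) v≢a+1
    = refl

  above-a+2 : above (suc (suc a)) ≡ (c , Sign.+) ∷ []
  above-a+2 =
    above-ordinary (ℕ.>⇒≢ (ℕ.<-trans m<a a<a+2)) (ℕ.>⇒≢ (ℕ.<-trans b₁<a a<a+2)) (ℕ.>⇒≢ a<a+2) (ℕ.>⇒≢ a+1<a+2)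
    where
    a<a+2 = ℕ.<-trans a<a+1 a+1<a+2

  above-quadrangle : ∀ i → suc i ℕ.< 4 → above (i ℕ.+ a) ≡ shift a (negativeQuadrangle i)
  above-quadrangle 0 _ = above-a
  above-quadrangle 1 _ = above-a+1
  above-quadrangle 2 _ = above-a+2
  above-quadrangle (suc (suc (suc i))) (ℕ.s≤s (ℕ.s≤s (ℕ.s≤s (ℕ.s≤s ()))))

  private
    n≡1+c : n ≡ suc c
    n≡1+c = count m
      where
      count : ∀ m → 4 ℕ.* suc m ℕ.+ 3 ≡ suc (3 ℕ.+ (m ℕ.+ suc (suc (m ℕ.+ m) ℕ.+ suc m)))
      count = ℕ-RingSolver.solve-∀
    c-last : suc (m ℕ.+ 3) ℕ.+ b₁ ≡ c
    c-last = shuffle m b₁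
      where
      shuffle : ∀ m b → suc (m ℕ.+ 3) ℕ.+ b ≡ 3 ℕ.+ (m ℕ.+ suc b)
      shuffle = ℕ-RingSolver.solve-∀
    n-split : ∀ m → 4 ℕ.* suc m ℕ.+ 3 ≡ m ℕ.+ suc (suc (m ℕ.+ m) ℕ.+ suc (suc (m ℕ.+ 3)))
    n-split = ℕ-RingSolver.solve-∀
    n-halve : ∀ m → 1 ℕ.+ (4 ℕ.* suc m ℕ.+ 3) ≡ 2 ℕ.+ ((3 ℕ.+ (m ℕ.+ m)) ℕ.+ (3 ℕ.+ (m ℕ.+ m)))
    n-halve = ℕ-RingSolver.solve-∀
    halve : ∀ m → 4 ℕ.+ (m ℕ.+ m) ≡ 2 ℕ.+ (suc m ℕ.+ suc m)
    halve m = cong (3 ℕ.+_) (sym (ℕ.+-suc m m))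

  module _ (x : ℤ) where

    f : ℕ → ℕ → ℤ
    f = charMatrix x (edgeOf above)

    pathVertex-below-a : ∀ {v} → v ≢ m → v ≢ b₁ → v ℕ.< a → PathVertex f x v
    pathVertex-below-a v≢m v≢b₁ v<a =
      pathVertex above x (above-ordinary v≢m v≢b₁ (ℕ.<⇒≢ v<a) (ℕ.<⇒≢ (ℕ.<-trans v<a a<a+1)))

    head : ∀ i → i ℕ.< m → PathVertex f x (i ℕ.+ 0)
    head i i<m = pathVertex-below-a (ℕ.<⇒≢ v<m) (ℕ.<⇒≢ (ℕ.<-trans v<m m<b₁)) (ℕ.<-trans v<m m<a)
      where v<m = subst (ℕ._< m) (sym (ℕ.+-identityʳ i)) i<m

    longTail : ∀ i → i ℕ.< suc (m ℕ.+ m) → PathVertex f x (i ℕ.+ suc m)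
    longTail i i<2m+1 = pathVertex-below-a (ℕ.>⇒≢ m<v) (ℕ.<⇒≢ v<b₁) (ℕ.<-trans v<b₁ b₁<a)
      where
      m<v = ℕ.m≤n+m (suc m) i
      v<b₁ = ℕ.+-monoˡ-< (suc m) i<2m+1

    shortTail : ∀ i → i ℕ.< m → PathVertex f x (i ℕ.+ suc b₁)
    shortTail i i<m = pathVertex-below-a (ℕ.>⇒≢ (ℕ.<-trans m<b₁ b₁<v)) (ℕ.>⇒≢ b₁<v) (ℕ.+-monoˡ-< (suc b₁) i<m)
      where b₁<v = ℕ.m≤n+m (suc b₁) i

    quadrangle : ∀ s n → s ℕ.+ n ℕ.≤ 4 →
                 principalMinor f (s ℕ.+ a) n ≡ principalMinor (charMatrix x (edgeOf negativeQuadrangle)) s n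
    quadrangle = principalMinor-translate f (charMatrix x (edgeOf negativeQuadrangle)) a 4 λ i j i<4 j<4 →
      cong₂ (λ d e → x * d - entry e) (δ-translate a i j)
            (edgeOf-translate above negativeQuadrangle a 4 above-quadrangle i j i<4 j<4)

    minor-shortTail+quadrangle : principalMinor f (suc b₁) (suc (m ℕ.+ 3)) ≡ V x (suc m) * (x * x - + 2)
    minor-shortTail+quadrangle = begin
        principalMinor f (suc b₁) (suc (m ℕ.+ 3))
      ≡⟨ cong (principalMinor f (suc b₁)) (ℕ.+-suc m 3) ⟨
        principalMinor f (suc b₁) (m ℕ.+ 4)
      ≡⟨ principalMinor-pathSegment f x (suc b₁) m 3 shortTail ⟩
        U x (suc m) * principalMinor f a 4 - U x m * principalMinor f (suc a) 3
      ≡⟨ cong₂ (λ p q → U x (suc m) * p - U x m * q)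
               (trans (quadrangle 0 4 ℕ.≤-refl) (negativeQuadrangle-0-4 x))
               (trans (quadrangle 1 3 ℕ.≤-refl) (negativeQuadrangle-1-3 x)) ⟩
        U x (suc m) * ((x * x - + 2) * (x * x - + 2)) - U x m * (x * x * x - + 2 * x)
      ≡⟨ factor x (U x (suc m)) (U x m) ⟩
        V x (suc m) * (x * x - + 2)
      ∎
      where
      factor : ∀ x p q → p * ((x * x - + 2) * (x * x - + 2)) - q * (x * x * x - + 2 * x)
                         ≡ (x * (x * p - q) - p - p) * (x * x - + 2)
      factor = solve-∀

    minor-shortTail+quadrangle∖c : principalMinor f (suc b₁) (m ℕ.+ 3) ≡ V x (suc m) * x
    minor-shortTail+quadrangle∖c = begin
        principalMinor f (suc b₁) (m ℕ.+ 3)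
      ≡⟨ principalMinor-pathSegment f x (suc b₁) m 2 shortTail ⟩
        U x (suc m) * principalMinor f a 3 - U x m * principalMinor f (suc a) 2
      ≡⟨ cong₂ (λ p q → U x (suc m) * p - U x m * q)
               (trans (quadrangle 0 3 (ℕ.n≤1+n 3)) (negativeQuadrangle-0-3 x))
               (trans (quadrangle 1 2 (ℕ.n≤1+n 3)) (negativeQuadrangle-1-2 x)) ⟩
        U x (suc m) * (x * x * x - + 2 * x) - U x m * (x * x)
      ≡⟨ factor x (U x (suc m)) (U x m) ⟩
        V x (suc m) * x
      ∎
      where
      factor : ∀ x p q → p * (x * x * x - + 2 * x) - q * (x * x) ≡ (x * (x * p - q) - p - p) * x
      factor = solve-∀

    minor-b₁ : principalMinor f b₁ (suc (suc (m ℕ.+ 3))) ≡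
               x * principalMinor f (suc b₁) (suc (m ℕ.+ 3)) - principalMinor f (suc b₁) (m ℕ.+ 3)
    minor-b₁ = begin
        principalMinor f b₁ (suc (suc (m ℕ.+ 3)))
      ≡⟨ principalMinor-pendantLast f b₁ (m ℕ.+ 3) (λ j b₁<j j<c → proj₁ (nonEdge j b₁<j j<c))
                                                   (λ j b₁<j j<c → proj₂ (nonEdge j b₁<j j<c)) ⟩
        f b₁ b₁ * A - f b₁ (suc (m ℕ.+ 3) ℕ.+ b₁) * f (suc (m ℕ.+ 3) ℕ.+ b₁) b₁ * A′
      ≡⟨ cong₂ (λ d e → d * A - e * A′) (charMatrix-diagonal x (edgeOf above) b₁ (edgeOf-loop above b₁))
                                         (trans (cong (λ l → f b₁ l * f l b₁) c-last) link) ⟩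
        x * A - 1ℤ * A′
      ≡⟨ cong (λ e → x * A - e) (*-identityˡ A′) ⟩
        x * A - A′
      ∎
      where
      A = principalMinor f (suc b₁) (suc (m ℕ.+ 3))
      A′ = principalMinor f (suc b₁) (m ℕ.+ 3)
      nonEdge : ∀ j → b₁ ℕ.< j → j ℕ.< suc (m ℕ.+ 3) ℕ.+ b₁ → f j b₁ ≡ 0ℤ × f b₁ j ≡ 0ℤ
      nonEdge j b₁<j j<c =
        charMatrix-nonEdge x (edgeOf above) (ℕ.>⇒≢ b₁<j) (proj₁ b₁j-nonEdge) ,
        charMatrix-nonEdge x (edgeOf above) (ℕ.<⇒≢ b₁<j) (proj₂ b₁j-nonEdge)
        where
        b₁j-nonEdge = pendantAbove-nonEdge above above-b₁ j b₁<j (ℕ.<⇒≢ (subst (j ℕ.<_) c-last j<c))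
      link : f b₁ c * f c b₁ ≡ 1ℤ
      link = charMatrix-link x (edgeOf above) (ℕ.<⇒≢ b₁<c) (proj₁ b₁c-edge) (proj₂ b₁c-edge)
        where
        b₁c-edge = pendantAbove-edge above above-b₁ b₁<c

    minor-H : principalMinor f (suc m) (suc (m ℕ.+ m) ℕ.+ suc (suc (m ℕ.+ 3))) ≡
              V x (suc m) * V x (suc (suc (suc (m ℕ.+ m))))
    minor-H = begin
        principalMinor f (suc m) (L ℕ.+ suc (suc (m ℕ.+ 3)))
      ≡⟨ principalMinor-pathSegment f x (suc m) L (suc (m ℕ.+ 3)) longTail ⟩
        U x (suc L) * principalMinor f b₁ (suc (suc (m ℕ.+ 3))) - U x L * A
      ≡⟨ cong (λ e → U x (suc L) * e - U x L * A) minor-b₁ ⟩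
        U x (suc L) * (x * A - A′) - U x L * A
      ≡⟨ cong₂ (λ p q → U x (suc L) * (x * p - q) - U x L * p) minor-shortTail+quadrangle minor-shortTail+quadrangle∖c ⟩
        U x (suc L) * (x * (t * (x * x - + 2)) - t * x) - U x L * (t * (x * x - + 2))
      ≡⟨ factor x t (U x (suc L)) (U x L) ⟩
        t * V x (suc (suc L))
      ∎
      where
      L = suc (m ℕ.+ m)
      t = V x (suc m)
      A = principalMinor f (suc b₁) (suc (m ℕ.+ 3))
      A′ = principalMinor f (suc b₁) (m ℕ.+ 3)
      factor : ∀ x t u w → u * (x * (t * (x * x - + 2)) - t * x) - w * (t * (x * x - + 2))
                           ≡ t * (x * (x * (x * u - w) - u) - (x * u - w) - (x * u - w))
      factor = solve-∀

    charPoly-Γ : charPoly Γ x ≡ U x (suc n)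
    charPoly-Γ = begin
        charPoly Γ x
      ≡⟨ charPoly-principalMinor Γ (edgeOf above) (λ _ _ → refl) x ⟩
        principalMinor f 0 n
      ≡⟨ cong (principalMinor f 0) (n-split m) ⟩
        principalMinor f 0 (m ℕ.+ suc s)
      ≡⟨ principalMinor-pathComponent f x 0 m s head
           (charMatrix-diagonal x (edgeOf above) (m ℕ.+ 0) (edgeOf-loop above (m ℕ.+ 0)))
           (subst (λ v → ∀ j → v ℕ.< j → f j v ≡ 0ℤ) (sym (ℕ.+-identityʳ m)) isolated) ⟩
        U x (suc (suc m)) * principalMinor f (suc (m ℕ.+ 0)) s
      ≡⟨ cong (λ d → U x (suc (suc m)) * principalMinor f (suc d) s) (ℕ.+-identityʳ m) ⟩
        U x (suc (suc m)) * principalMinor f (suc m) s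
      ≡⟨ cong (U x (suc (suc m)) *_) minor-H ⟩
        U x (suc (suc m)) * (V x (suc m) * V x a′)
      ≡⟨ *-assoc (U x (suc (suc m))) (V x (suc m)) (V x a′) ⟨
        U x (suc (suc m)) * V x (suc m) * V x a′
      ≡⟨ cong (_* V x a′) (trans (cong (U x) (halve m)) (U-double x (suc m))) ⟨
        U x (suc a′) * V x a′
      ≡⟨ trans (cong (U x) (n-halve m)) (U-double x a′) ⟨
        U x (suc n)
      ∎
      where
      s = suc (m ℕ.+ m) ℕ.+ suc (suc (m ℕ.+ 3))
      a′ = suc (suc (suc (m ℕ.+ m)))
      isolated : ∀ j → m ℕ.< j → f j m ≡ 0ℤ
      isolated j m<j = charMatrix-nonEdge x (edgeOf above) (ℕ.>⇒≢ m<j) (isolatedAbove above above-m j m<j)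

  Γ-branchVertex : BranchVertex Γ
  Γ-branchVertex = record
    { centre    = Fin.fromℕ< c<n
    ; u₁        = vertex b₁<c
    ; u₂        = vertex a+1<c
    ; u₃        = vertex a+2<c
    ; adjacent₁ = adjacent b₁<c (proj₂ (pendantAbove-edge above above-b₁ b₁<c))
    ; adjacent₂ = adjacent a+1<c (proj₂ (pendantAbove-edge above above-a+1 a+1<c))
    ; adjacent₃ = adjacent a+2<c (proj₂ (pendantAbove-edge above above-a+2 a+2<c))
    ; u₁≢u₂     = distinct b₁<c a+1<c (ℕ.<⇒≢ (ℕ.<-trans b₁<a a<a+1))
    ; u₁≢u₃     = distinct b₁<c a+2<c (ℕ.<⇒≢ (ℕ.<-trans (ℕ.<-trans b₁<a a<a+1) a+1<a+2))
    ; u₂≢u₃     = distinct a+1<c a+2<c (ℕ.<⇒≢ a+1<a+2)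
    }
    where
    c<n : c ℕ.< n
    c<n = subst (c ℕ.<_) (sym n≡1+c) (ℕ.n<1+n c)
    vertex : ∀ {u} → u ℕ.< c → Fin n
    vertex u<c = Fin.fromℕ< (ℕ.<-trans u<c c<n)
    adjacent : ∀ {u} (u<c : u ℕ.< c) → edgeOf above c u ≡ just Sign.+ → edge Γ (Fin.fromℕ< c<n) (vertex u<c) ≢ nothing
    adjacent u<c c~u c≁u with trans (sym c~u)
      (trans (cong₂ (edgeOf above) (sym (Fin.toℕ-fromℕ< c<n)) (sym (Fin.toℕ-fromℕ< (ℕ.<-trans u<c c<n)))) c≁u)
    ... | ()
    distinct : ∀ {u w} (u<c : u ℕ.< c) (w<c : w ℕ.< c) → u ≢ w → vertex u<c ≢ vertex w<c
    distinct u<c w<c u≢w = u≢w ∘ Fin.fromℕ<-injective _ _ (ℕ.<-trans u<c c<n) (ℕ.<-trans w<c c<n)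

open import Data.Nat using (_+_; _*_; _≤_)
open import Data.Product using (Σ; _×_; _,_)

theorem5p2 : (k : ℕ) → 1 ≤ k →
    Σ (SignedGraph (4 * k + 3)) λ Γ →
      Cospectral Γ (path (4 * k + 3)) × ¬ SwitchingIsomorphic Γ (path (4 * k + 3))
theorem5p2 zero    ()
theorem5p2 (suc m) _ =
  Γ ,
  (λ x → trans (charPoly-Γ x) (sym (charPoly-path n x))) ,
  (λ switching → path-noBranchVertex n (branchVertex-transport switching Γ-branchVertex))
  where open Construction m
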